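{- Let $\mathcal{F}$ be a finite union-closed family of sets with $\emptyset\notin\mathcal{F}$, $\bigcup_{A\in\mathcal{F}}A=\{1,\dots,n\}$ and $|\mathcal{F}|=m$, with height decomposition $\mathcal{F}=\bigcup_{i=1}^{H}\pi_i$, $H=H(\mathcal{F})$. Then: (i) for every $k$ with $1\le k\le H$, the $k$-th height contains at least one set with at most $n+1-k$ elements; (ii) $1\le H(\mathcal{F})\le n$; (iii) there exists an element $x\in\{1,\dots,n\}$ such that for every $i\in\{1,\dots,H\}$, $x$ belongs to at least one set of $\pi_i$; (iv) if $A,B$ lie in the same height and $A\neq B$, then $A\not\subset B$ and $B\not\subset A$; (v) if $A,B\in\mathcal{F}$ with $B\subset A$ and $B\neq A$, then the height number of $A$ is strictly smaller than the height number of $B$; (vi) every set in the 2nd height of $\mathcal{F}$ has at most $n-1$ elements.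
   Context: A union-closed family is a finite family $\mathcal{F}$ of finite sets closed under pairwise union. Height decomposition: $\pi_1$ is the set of inclusion-minimal members of $\mathcal{F}$; inductively, while $\mathcal{F}\setminus(\pi_1\cup\dots\cup\pi_{i-1})\neq\emptyset$, $\pi_i$ is the set of inclusion-minimal members of $\mathcal{F}\setminus(\pi_1\cup\dots\cup\pi_{i-1})$; the number $H$ of steps until $\mathcal{F}$ is exhausted is the height number $H(\mathcal{F})$. For $1\le j\le H$, the $j$-th height of $\mathcal{F}$ is $\pi_{H+1-j}$ (so the 1st height is $\pi_H=\{\{1,\dots,n\}\}$ and the $H$-th height is $\pi_1$). The height number of a set $A\in\mathcal{F}$ is the $j$ such that $A$ lies in the $j$-th height. -}

module Defs where

open import Data.Nat using (ℕ; zero; suc; _∸_; _≤_)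
open import Data.Product using (_×_)
open import Data.List using (List; []; _∷_; filter; length)
open import Data.List.Relation.Unary.All using (All; all?)
open import Data.List.Membership.Propositional renaming (_∈_ to _∈ᶠ_)
open import Data.Fin.Subset using (Subset; _⊂_; _∪_)
open import Data.Fin.Subset.Properties using (_⊂?_)
open import Relation.Nullary using (¬_; ¬?)
open import Relation.Unary using (Decidable)

private
  variable
    n : ℕ

IsMinimalIn : List (Subset n) → Subset n → Set
IsMinimalIn L A = All (λ B → ¬ (B ⊂ A)) L

minimal? : (L : List (Subset n)) → Decidable (IsMinimalIn L)
minimal? L A = all? (λ B → ¬? (B ⊂? A)) L

minimals : List (Subset n) → List (Subset n)
minimals L = filter (minimal? L) L

nonMinimals : List (Subset n) → List (Subset n)
nonMinimals L = filter (λ A → ¬? (minimal? L A)) L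

-- remaining F i = F ∖ (π₁ ∪ … ∪ π_i)
remaining : List (Subset n) → ℕ → List (Subset n)
remaining F zero    = F
remaining F (suc i) = nonMinimals (remaining F i)

-- π F i = π_i of the height decomposition (paper indices start at 1; π F 0 = [] is unused)
π : List (Subset n) → ℕ → List (Subset n)
π F zero    = []
π F (suc i) = minimals (remaining F i)

-- number of "remove the minimal members" steps until the list is exhausted,
-- with fuel (length F steps always suffice, each step removes ≥ 1 member)
steps : ℕ → List (Subset n) → ℕ
steps zero    _       = 0
steps (suc f) []      = 0
steps (suc f) (A ∷ L) = suc (steps f (nonMinimals (A ∷ L)))

heightNumber : List (Subset n) → ℕ
heightNumber F = steps (length F) F

height : List (Subset n) → ℕ → List (Subset n)
height F j = π F (suc (heightNumber F) ∸ j)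

HasHeightNumber : List (Subset n) → Subset n → ℕ → Set
HasHeightNumber F A j = (1 ≤ j) × (j ≤ heightNumber F) × (A ∈ᶠ height F j)

UnionClosed : List (Subset n) → Set
UnionClosed F = ∀ {A B} → A ∈ᶠ F → B ∈ᶠ F → (A ∪ B) ∈ᶠ F

module Submission where

-- Every set of π_{i+2} properly contains a set of π_{i+1}: it is not minimal once π_1, …, π_i are
-- removed, and below any set lies a minimal one. Descending from a set X of the top level π_H gives
-- X = Z_H ⊃ … ⊃ Z_1 with Z_j ∈ π_j, so |Z_j| ≤ n − (H − j); an element of the nonempty Z_1 lies in
-- every Z_j, and |Z_1| ≥ 1 forces H ≤ n. Since π_{i+1} is minimal in a family containing all later
-- levels, proper inclusion strictly raises the level, which gives (iv), (v), and (vi): a set ⊤ in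
-- π_{H-1} would properly contain the set of π_{H-1} below X.

open import Defs
open import Data.Nat using (ℕ; suc; _∸_; _≤_; _<_)
open import Data.Product using (_×_; ∃-syntax)
open import Data.List using (List; [])
open import Data.List.Relation.Unary.Unique.Propositional using (Unique)
open import Data.List.Membership.Propositional renaming (_∈_ to _∈ᶠ_; _∉_ to _∉ᶠ_)
open import Data.Fin.Subset using (Subset; _∈_; _⊆_; _⊂_; ⋃; ⊤; ⊥; ∣_∣)
open import Relation.Nullary using (¬_)
open import Relation.Binary.PropositionalEquality using (_≡_; _≢_)

open import Data.Nat using (zero; z≤n; s≤s; _+_; _≤′_; ≤′-reflexive; ≤′-step)
open import Data.Nat.Properties
  using ( ≤-refl; ≤-reflexive; ≤-trans; <-irrefl; _<?_; ≮⇒≥; ≤⇒≤′; ≤∧≢⇒<; <⇒≤pred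
        ; suc-injective; +-identityʳ; +-suc; +-monoˡ-≤; m+n≤o⇒m≤o∸n; ∸-monoʳ-≤; ∸-cancelʳ-<; m∸[m∸n]≡n
        ; module ≤-Reasoning)
open import Data.Product using (_,_; proj₁; proj₂)
open import Data.List using (_∷_; length)
open import Data.List.Relation.Unary.Any using (here)
import Data.List.Relation.Unary.All as All
open import Data.List.Relation.Unary.All.Properties using (¬All⇒Any¬)
open import Data.List.Membership.Propositional.Properties using (∈-filter⁺; ∈-filter⁻)
open import Data.Vec.Base using ([]; _∷_; here)
open import Data.Fin.Subset using (Nonempty; inside; outside)
open import Data.Fin.Subset.Properties
  using ( drop-∷-⊆; s⊂s; out⊂in; ⊆-trans; ⊆-⊂-trans; ⊂-⊆-trans; _⊂?_; ⊆⊤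
        ; ∣p∣≤n; ∣p∣≡n⇒p≡⊤; p⊂q⇒∣p∣<∣q∣; x∈p⇒∣p-x∣<∣p∣; nonempty?; Empty-unique)
open import Data.Fin.Subset.Induction using (⊂-wellFounded)
open import Induction.WellFounded using (Acc; acc)
open import Function using (_∘_; id)
open import Relation.Nullary using (yes; no; ¬?)
open import Relation.Nullary.Decidable using (decidable-stable)
open import Relation.Nullary.Negation using (contradiction)
open import Relation.Binary.PropositionalEquality using (refl; sym; cong; subst)

private
  variable
    n i j : ℕ
    A B X : Subset n
    L : List (Subset n)

⊆∧≢⇒⊂ : A ⊆ B → A ≢ B → A ⊂ B
⊆∧≢⇒⊂ {A = []}          {[]}          _   A≢B = contradiction refl A≢B
⊆∧≢⇒⊂ {A = outside ∷ A} {inside ∷ B}  A⊆B _   = out⊂in (drop-∷-⊆ A⊆B)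
⊆∧≢⇒⊂ {A = inside ∷ A}  {outside ∷ B} A⊆B _   = contradiction (A⊆B here) λ ()
⊆∧≢⇒⊂ {A = outside ∷ A} {outside ∷ B} A⊆B A≢B =
  s⊂s (⊆∧≢⇒⊂ (drop-∷-⊆ A⊆B) (A≢B ∘ cong (outside ∷_)))
⊆∧≢⇒⊂ {A = inside ∷ A}  {inside ∷ B}  A⊆B A≢B =
  s⊂s (⊆∧≢⇒⊂ (drop-∷-⊆ A⊆B) (A≢B ∘ cong (inside ∷_)))

p≢⊤⇒∣p∣<n : {A : Subset n} → A ≢ ⊤ → ∣ A ∣ < n
p≢⊤⇒∣p∣<n {A = A} A≢⊤ = ≤∧≢⇒< (∣p∣≤n A) (A≢⊤ ∘ ∣p∣≡n⇒p≡⊤)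

x∈p⇒0<∣p∣ : ∀ {x} → x ∈ A → 0 < ∣ A ∣
x∈p⇒0<∣p∣ x∈A = ≤-trans (s≤s z≤n) (x∈p⇒∣p-x∣<∣p∣ x∈A)

∈-∉⊥⇒nonempty : ⊥ ∉ᶠ L → X ∈ᶠ L → Nonempty X
∈-∉⊥⇒nonempty {X = X} ⊥∉L X∈L =
  decidable-stable (nonempty? X) λ X-empty → ⊥∉L (subst (_∈ᶠ _) (Empty-unique X-empty) X∈L)

¬minimal⇒∃⊂ : ¬ IsMinimalIn L X → ∃[ C ] (C ∈ᶠ L × C ⊂ X)
¬minimal⇒∃⊂ {L = L} {X = X} ¬min =
  let C , C∈L , ¬¬C⊂X = find (¬All⇒Any¬ (λ B → ¬? (B ⊂? X)) L ¬min)
  in  C , C∈L , decidable-stable (C ⊂? X) ¬¬C⊂X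

minimal-below : B ∈ᶠ L → ∃[ Y ] (Y ∈ᶠ minimals L × Y ⊆ B)
minimal-below {B = B} = go (⊂-wellFounded B)
  where
  go : ∀ {B} → Acc _⊂_ B → B ∈ᶠ L → ∃[ Y ] (Y ∈ᶠ minimals L × Y ⊆ B)
  go {L = L} {B} (acc smaller) B∈L with minimal? L B
  ... | yes min = B , ∈-filter⁺ (minimal? L) B∈L min , id
  ... | no ¬min =
    let C , C∈L , C⊂B = ¬minimal⇒∃⊂ ¬min
        Y , Y∈ , Y⊆C  = go (smaller C⊂B) C∈L
    in  Y , Y∈ , ⊆-trans Y⊆C (proj₁ C⊂B)

remaining-shift : ∀ (L : List (Subset n)) i → remaining L (suc i) ≡ remaining (nonMinimals L) i
remaining-shift L zero    = refl
remaining-shift L (suc i) = cong nonMinimals (remaining-shift L i)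

steps≡suc⇒remaining-nonempty : ∀ f (L : List (Subset n)) {s} → steps f L ≡ suc s
  → ∃[ A ] (A ∈ᶠ remaining L s)
steps≡suc⇒remaining-nonempty (suc f) (A ∷ _) {zero} _  = A , here refl
steps≡suc⇒remaining-nonempty (suc f) L@(_ ∷ _) {suc s} eq =
  let A , A∈ = steps≡suc⇒remaining-nonempty f (nonMinimals L) (suc-injective eq)
  in  A , subst (A ∈ᶠ_) (sym (remaining-shift L s)) A∈

steps≡suc⇒π-nonempty : ∀ f (L : List (Subset n)) {s} → steps f L ≡ suc s → ∃[ X ] (X ∈ᶠ π L (suc s))
steps≡suc⇒π-nonempty f L eq =
  let A , A∈     = steps≡suc⇒remaining-nonempty f L eq
      X , X∈ , _ = minimal-below A∈
  in  X , X∈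

module _ {n : ℕ} (L : List (Subset n)) where

  π-minimal : ∀ i → A ∈ᶠ π L (suc i) → A ∈ᶠ remaining L i × IsMinimalIn (remaining L i) A
  π-minimal i = ∈-filter⁻ (minimal? (remaining L i))

  remaining-step : ∀ i → A ∈ᶠ remaining L (suc i)
    → A ∈ᶠ remaining L i × ¬ IsMinimalIn (remaining L i) A
  remaining-step i = ∈-filter⁻ (λ A → ¬? (minimal? (remaining L i) A))

  remaining-antitone : i ≤ j → A ∈ᶠ remaining L j → A ∈ᶠ remaining L i
  remaining-antitone = go ∘ ≤⇒≤′
    where
    go : i ≤′ j → A ∈ᶠ remaining L j → A ∈ᶠ remaining L i
    go (≤′-reflexive refl)    A∈ = A∈
    go (≤′-step {j} i≤′j)     A∈ = go i≤′j (proj₁ (remaining-step j A∈))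

  π-strictMono : ∀ i j → A ∈ᶠ π L i → B ∈ᶠ π L j → B ⊂ A → j < i
  π-strictMono (suc i) (suc j) A∈ B∈ B⊂A with j <? i
  ... | yes j<i = s≤s j<i
  ... | no  j≮i = contradiction B⊂A (All.lookup (proj₂ (π-minimal i A∈))
                    (remaining-antitone (≮⇒≥ j≮i) (proj₁ (π-minimal j B∈))))

  π-antichain : ∀ i → A ∈ᶠ π L i → B ∈ᶠ π L i → A ≢ B → ¬ (A ⊆ B)
  π-antichain i A∈ B∈ A≢B A⊆B = <-irrefl refl (π-strictMono i i B∈ A∈ (⊆∧≢⇒⊂ A⊆B A≢B))

  π-stepDown : ∀ i → X ∈ᶠ π L (suc (suc i)) → ∃[ W ] (W ∈ᶠ π L (suc i) × W ⊂ X)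
  π-stepDown i X∈ =
    let _ , ¬min     = remaining-step i (proj₁ (π-minimal (suc i) X∈))
        C , C∈ , C⊂X = ¬minimal⇒∃⊂ ¬min
        W , W∈ , W⊆C = minimal-below C∈
    in  W , W∈ , ⊆-⊂-trans W⊆C C⊂X

  -- Z_d is the d-th set of a chain X ⊃ Z₁ ⊃ … descending one level at a time; x lies in its last set.
  descendingChain : ⊥ ∉ᶠ L → ∀ i → X ∈ᶠ π L (suc i)
    → ∃[ x ] (x ∈ X × (∀ d → d ≤ i
        → ∃[ Z ] (Z ∈ᶠ π L (suc i ∸ d) × x ∈ Z × ∣ Z ∣ + d ≤ ∣ X ∣)))
  descendingChain {X = X} ⊥∉L zero X∈ with ∈-∉⊥⇒nonempty ⊥∉L (proj₁ (π-minimal 0 X∈))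
  ... | x , x∈X = x , x∈X , λ { zero z≤n → X , X∈ , x∈X , ≤-reflexive (+-identityʳ ∣ X ∣) }
  descendingChain {X = X} ⊥∉L (suc i) X∈ with π-stepDown i X∈
  ... | W , W∈ , W⊂X with descendingChain ⊥∉L i W∈
  ... | x , x∈W , chain = x , proj₁ W⊂X x∈W , λ where
    zero    _         → X , X∈ , proj₁ W⊂X x∈W , ≤-reflexive (+-identityʳ ∣ X ∣)
    (suc d) (s≤s d≤i) →
      let Z , Z∈ , x∈Z , size = chain d d≤i
          open ≤-Reasoning
      in  Z , Z∈ , x∈Z , (begin
            ∣ Z ∣ + suc d   ≡⟨ +-suc ∣ Z ∣ d ⟩
            suc (∣ Z ∣ + d) ≤⟨ s≤s size ⟩
            suc ∣ W ∣       ≤⟨ p⊂q⇒∣p∣<∣q∣ W⊂X ⟩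
            ∣ X ∣           ∎)

  small-set-in-every-height : ⊥ ∉ᶠ L → ∀ s → X ∈ᶠ π L (suc s)
    → ∀ k → 1 ≤ k → k ≤ suc s → ∃[ A ] (A ∈ᶠ π L (suc (suc s) ∸ k) × ∣ A ∣ ≤ suc n ∸ k)
  small-set-in-every-height {X = X} ⊥∉L s X∈ (suc d) _ (s≤s d≤s) =
    let _ , _ , chain     = descendingChain ⊥∉L s X∈
        Z , Z∈ , _ , size = chain d d≤s
    in  Z , Z∈ , m+n≤o⇒m≤o∸n ∣ Z ∣ (≤-trans size (∣p∣≤n X))

  height≤n : ⊥ ∉ᶠ L → ∀ s → X ∈ᶠ π L (suc s) → suc s ≤ n
  height≤n {X = X} ⊥∉L s X∈ =
    let _ , _ , chain      = descendingChain ⊥∉L s X∈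
        Z , _ , x∈Z , size = chain s ≤-refl
    in  ≤-trans (+-monoˡ-≤ s (x∈p⇒0<∣p∣ x∈Z)) (≤-trans size (∣p∣≤n X))

  element-in-every-level : ⊥ ∉ᶠ L → ∀ s → X ∈ᶠ π L (suc s)
    → ∃[ x ] (∀ i → 1 ≤ i → i ≤ suc s → ∃[ A ] (A ∈ᶠ π L i × x ∈ A))
  element-in-every-level ⊥∉L s X∈ =
    let x , _ , chain = descendingChain ⊥∉L s X∈
    in  x , λ i 1≤i i≤ →
          let Z , Z∈ , x∈Z , _ = chain (suc s ∸ i) (∸-monoʳ-≤ (suc s) 1≤i)
          in  Z , subst (λ j → Z ∈ᶠ π L j) (m∸[m∸n]≡n i≤) Z∈ , x∈Z

  height-antichain : ∀ H j → A ∈ᶠ π L (suc H ∸ j) → B ∈ᶠ π L (suc H ∸ j)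
    → A ≢ B → ¬ (A ⊆ B) × ¬ (B ⊆ A)
  height-antichain H j A∈ B∈ A≢B =
    π-antichain (suc H ∸ j) A∈ B∈ A≢B , π-antichain (suc H ∸ j) B∈ A∈ (A≢B ∘ sym)

  height-strictAnti : ∀ H jA jB → A ∈ᶠ π L (suc H ∸ jA) → B ∈ᶠ π L (suc H ∸ jB)
    → B ⊂ A → jA < jB
  height-strictAnti H jA jB A∈ B∈ B⊂A =
    ∸-cancelʳ-< (π-strictMono (suc H ∸ jA) (suc H ∸ jB) A∈ B∈ B⊂A)

  below-top-≤n∸1 : ∀ s → X ∈ᶠ π L (suc s) → A ∈ᶠ π L s → ∣ A ∣ ≤ n ∸ 1
  below-top-≤n∸1 {A = A} (suc s) X∈ A∈ = <⇒≤pred (p≢⊤⇒∣p∣<n A≢⊤)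
    where
    A≢⊤ : A ≢ ⊤
    A≢⊤ A≡⊤ =
      let W , W∈ , W⊂X = π-stepDown s X∈
      in  <-irrefl refl (π-strictMono (suc s) (suc s) A∈ W∈
            (subst (_ ⊂_) (sym A≡⊤) (⊂-⊆-trans W⊂X ⊆⊤)))

mainTheorem2 : (n : ℕ) (F : List (Subset n))
    → Unique F → F ≢ [] → UnionClosed F → ⊥ ∉ᶠ F → ⋃ F ≡ ⊤
    → (∀ k → 1 ≤ k → k ≤ heightNumber F
    → ∃[ A ] (A ∈ᶠ height F k × ∣ A ∣ ≤ suc n ∸ k))
    × (1 ≤ heightNumber F × heightNumber F ≤ n)
    × (∃[ x ] (∀ i → 1 ≤ i → i ≤ heightNumber F → ∃[ A ] (A ∈ᶠ π F i × x ∈ A)))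
    × (∀ j A B → 1 ≤ j → j ≤ heightNumber F → A ∈ᶠ height F j → B ∈ᶠ height F j
    → A ≢ B → ¬ (A ⊆ B) × ¬ (B ⊆ A))
    × (∀ A B jA jB → A ∈ᶠ F → B ∈ᶠ F → B ⊂ A
    → HasHeightNumber F A jA → HasHeightNumber F B jB → jA < jB)
    × (∀ A → A ∈ᶠ height F 2 → ∣ A ∣ ≤ n ∸ 1)
mainTheorem2 n [] _ F≢[] _ _ _ = contradiction refl F≢[]
mainTheorem2 n F@(_ ∷ F′) _ _ _ ⊥∉F _ =
    small-set-in-every-height F ⊥∉F s X∈top
  , (s≤s z≤n , height≤n F ⊥∉F s X∈top)
  , element-in-every-level F ⊥∉F s X∈top
  , (λ j _ _ _ _ → height-antichain F H j)
  , (λ _ _ jA jB _ _ B⊂A (_ , _ , A∈) (_ , _ , B∈) → height-strictAnti F H jA jB A∈ B∈ B⊂A)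
  , (λ _ → below-top-≤n∸1 F s X∈top)
  where
  s = steps (length F′) (nonMinimals F)
  H = heightNumber F
  X∈top : proj₁ (steps≡suc⇒π-nonempty (length F) F refl) ∈ᶠ π F H
  X∈top = proj₂ (steps≡suc⇒π-nonempty (length F) F refl)
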